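{- Let $R$ be a transit function on a non-empty set $V$. If $R$ satisfies Axioms (JC) and (J2), then the underlying graph $G_R$ is chordal.
   Context: A transit function on a set $V$ is a map $R:V\times V\to 2^V$ such that for all $u,v\in V$: $u\in R(u,v)$, $R(u,v)=R(v,u)$ and $R(u,u)=\{u\}$. The underlying graph $G_R$ has vertex set $V$, and distinct $u,v$ are adjacent iff $R(u,v)=\{u,v\}$. A graph is chordal if it has no induced cycle of length at least four. The axioms (quantified over elements of $V$): (JC) If $u,x,y,v$ are pairwise distinct, $x\in R(u,y)$, $y\in R(x,v)$ and $R(x,y)=\{x,y\}$, then $x\in R(u,v)$. (J2) If $R(u,x)=\{u,x\}$, $R(x,v)=\{x,v\}$, $u\neq v$ and $R(u,v)\neq\{u,v\}$, then $x\in R(u,v)$. -}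

module Defs where

open import Level using (0ℓ)
open import Data.Nat using (ℕ; suc; _≤_)
open import Data.Fin using (Fin; toℕ)
open import Data.Sum using (_⊎_)
open import Data.Product using (_×_; Σ; ∃)
open import Data.Empty using (⊥)
open import Relation.Nullary using (¬_)
open import Relation.Unary using (Pred; _∈_; _≐_; _∪_; ｛_｝)
open import Relation.Binary.PropositionalEquality using (_≡_; _≢_)
open import Function.Bundles using (_⇔_)
open import Function.Definitions using (Injective)

pair : {V : Set} → V → V → Pred V 0ℓ
pair u v = ｛ u ｝ ∪ ｛ v ｝

record IsTransit {V : Set} (R : V → V → Pred V 0ℓ) : Set₁ where
  field
    refl-mem : ∀ u v → u ∈ R u v
    sym      : ∀ u v → R u v ≐ R v u
    idem     : ∀ u → R u u ≐ ｛ u ｝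

JC : {V : Set} → (V → V → Pred V 0ℓ) → Set
JC {V} R = ∀ (u x y v : V) →
  u ≢ x → u ≢ y → u ≢ v → x ≢ y → x ≢ v → y ≢ v →
  x ∈ R u y → y ∈ R x v → R x y ≐ pair x y → x ∈ R u v

J2 : {V : Set} → (V → V → Pred V 0ℓ) → Set
J2 {V} R = ∀ (u x v : V) →
  R u x ≐ pair u x → R x v ≐ pair x v → u ≢ v → ¬ (R u v ≐ pair u v) →
  x ∈ R u v

Adj : {V : Set} → (V → V → Pred V 0ℓ) → V → V → Set
Adj R u v = u ≢ v × (R u v ≐ pair u v)

CycNext : ∀ {n} → Fin n → Fin n → Set
CycNext {n} i j = suc (toℕ i) ≡ toℕ j ⊎ (suc (toℕ i) ≡ n × toℕ j ≡ 0)

CycAdj : ∀ {n} → Fin n → Fin n → Set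
CycAdj i j = CycNext i j ⊎ CycNext j i

IsInducedCycle : {V : Set} → (V → V → Set) → (n : ℕ) → (Fin n → V) → Set
IsInducedCycle E n c =
  Injective _≡_ _≡_ c × (∀ i j → i ≢ j → (E (c i) (c j) ⇔ CycAdj i j))

Chordal : {V : Set} → (V → V → Set) → Set
Chordal {V} E = ∀ (n : ℕ) → 4 ≤ n → (c : Fin n → V) → ¬ IsInducedCycle E n c

-- Along a path p₀ p₁ … pₖ of the underlying graph with no chords between vertices at distance
-- two, (J2) puts p₁ into R(p₀, p₂), and (JC) then propagates this: from p₁ ∈ R(p₀, p₂) and
-- p₂ ∈ R(p₁, pₖ) (by induction on the path p₁ … pₖ) we get p₁ ∈ R(p₀, pₖ). An induced cycle
-- c₀ … c_{n-1} of length n ≥ 4 yields such a path from c₀ to c_{n-1}; but c₀ c_{n-1} is an edge,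
-- so R(c₀, c_{n-1}) = {c₀, c_{n-1}} cannot contain c₁.
module Submission where

open import Defs
open import Level using (0ℓ)
open import Relation.Unary using (Pred; _∈_)
open import Data.Nat using (ℕ; zero; suc; pred; _+_; _≤_; _<_; NonZero; z≤n; s≤s; z<s; s<s)
open import Data.Nat.Properties using (≤-refl; <-trans; <⇒≢; 1+n≢n; 1+n≰n; m<n+m)
open import Data.Nat.DivMod using (_mod_; m<n⇒m%n≡m)
open import Data.Fin using (Fin; toℕ)
open import Data.Fin.Properties using (toℕ-fromℕ<)
open import Data.Sum using (_⊎_; inj₁; inj₂)
open import Data.Product using (_,_; proj₁; proj₂)
open import Function using (_∘_)
open import Function.Bundles using (Equivalence)
open import Relation.Nullary using (¬_)
open import Relation.Binary.PropositionalEquality using (_≡_; _≢_; refl; sym; trans; cong; subst)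

record IsShortChordFreePath {V : Set} (E : V → V → Set) (len : ℕ) (p : ℕ → V) : Set where
  field
    injective : ∀ {a b} → a < len → b < len → p a ≡ p b → a ≡ b
    edge      : ∀ {i} → suc i < len → E (p i) (p (suc i))
    no-chord  : ∀ {i} → suc (suc i) < len → ¬ E (p i) (p (suc (suc i)))

  distinct : ∀ {a b} → a < b → b < len → p a ≢ p b
  distinct a<b b<len = <⇒≢ a<b ∘ injective (<-trans a<b b<len) b<len

open IsShortChordFreePath

tail : ∀ {V} {E : V → V → Set} {len p} →
  IsShortChordFreePath E (suc len) p → IsShortChordFreePath E len (p ∘ suc)
tail P = record
  { injective = λ a<len b<len → cong pred ∘ injective P (s<s a<len) (s<s b<len)
  ; edge      = edge P ∘ s<s
  ; no-chord  = no-chord P ∘ s<s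
  }

module _ {V : Set} {R : V → V → Pred V 0ℓ} where

  adjacent-transit : ∀ {u v x} → Adj R u v → x ∈ R u v → u ≡ x ⊎ v ≡ x
  adjacent-transit (_ , R≐pair) = proj₁ R≐pair

  J2⇒second∈transit : J2 R → ∀ {len p} → IsShortChordFreePath (Adj R) len p → 2 < len →
    p 1 ∈ R (p 0) (p 2)
  J2⇒second∈transit j2 {p = p} P 2<len =
    j2 _ _ _ (proj₂ (edge P (<-trans ≤-refl 2<len))) (proj₂ (edge P 2<len)) p₀≢p₂
      (λ R≐pair → no-chord P 2<len (p₀≢p₂ , R≐pair))
    where
    p₀≢p₂ : p 0 ≢ p 2
    p₀≢p₂ = distinct P z<s 2<len

  JC+J2⇒second∈transit : JC R → J2 R → ∀ k {p} → IsShortChordFreePath (Adj R) (3 + k) p →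
    p 1 ∈ R (p 0) (p (2 + k))
  JC+J2⇒second∈transit jc j2 zero P = J2⇒second∈transit j2 P ≤-refl
  JC+J2⇒second∈transit jc j2 (suc k) {p} P =
    jc _ _ _ _ (p≢ z<s (s<s z<s)) (p≢ z<s (s<s (s<s z<s))) (p≢ z<s last) (p≢ (s<s z<s) (s<s (s<s z<s)))
      (p≢ (s<s z<s) last) (p≢ (s<s (s<s z<s)) last)
      (J2⇒second∈transit j2 P (s<s (s<s z<s)))
      (JC+J2⇒second∈transit jc j2 k (tail P))
      (proj₂ (edge P (s<s (s<s z<s))))
    where
    last : 3 + k < 4 + k
    last = ≤-refl
    p≢ : ∀ {a b} → a < b → b < 4 + k → p a ≢ p b
    p≢ = distinct P

-- A cycle read off as an infinite sequence; only its first n terms are ever used.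
unroll : ∀ {V : Set} {n} .{{_ : NonZero n}} → (Fin n → V) → ℕ → V
unroll {n = n} c k = c (k mod n)

toℕ-mod : ∀ {n k} .{{_ : NonZero n}} → k < n → toℕ (k mod n) ≡ k
toℕ-mod k<n = trans (toℕ-fromℕ< _) (m<n⇒m%n≡m k<n)

¬CycAdj-skip : ∀ {n} {i j : Fin n} → 4 ≤ n → toℕ j ≡ 2 + toℕ i → ¬ CycAdj i j
¬CycAdj-skip _ j≡2+i (inj₁ (inj₁ 1+i≡j)) = 1+n≢n (sym (trans 1+i≡j j≡2+i))
¬CycAdj-skip _ j≡2+i (inj₁ (inj₂ (_ , j≡0))) with trans (sym j≡2+i) j≡0
... | ()
¬CycAdj-skip {i = i} _ j≡2+i (inj₂ (inj₁ 1+j≡i)) =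
  <⇒≢ (m<n+m (toℕ i) {3} z<s) (sym (trans (cong suc (sym j≡2+i)) 1+j≡i))
¬CycAdj-skip {n} 4≤n j≡2+i (inj₂ (inj₂ (1+j≡n , i≡0))) = 1+n≰n (subst (4 ≤_) (sym 3≡n) 4≤n)
  where
  3≡n : 3 ≡ n
  3≡n = trans (cong (3 +_) (sym i≡0)) (trans (cong suc (sym j≡2+i)) 1+j≡n)

module _ {V : Set} {E : V → V → Set} {n} .{{_ : NonZero n}} {c : Fin n → V}
         (cycle : IsInducedCycle E n c) where

  private
    mod-≢ : ∀ {a b} → a < n → b < n → a ≢ b → a mod n ≢ b mod n
    mod-≢ a<n b<n a≢b a≡b = a≢b (trans (sym (toℕ-mod a<n)) (trans (cong toℕ a≡b) (toℕ-mod b<n)))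

  induced-cycle⇒path : 4 ≤ n → IsShortChordFreePath E n (unroll c)
  induced-cycle⇒path 4≤n = record
    { injective = λ a<n b<n ca≡cb →
        trans (sym (toℕ-mod a<n)) (trans (cong toℕ (proj₁ cycle ca≡cb)) (toℕ-mod b<n))
    ; edge      = λ {i} 1+i<n → let i<n = <-trans ≤-refl 1+i<n in
        Equivalence.from (proj₂ cycle _ _ (mod-≢ i<n 1+i<n (<⇒≢ ≤-refl)))
          (inj₁ (inj₁ (trans (cong suc (toℕ-mod i<n)) (sym (toℕ-mod 1+i<n)))))
    ; no-chord  = λ {i} 2+i<n chord → let i<n = <-trans (<-trans ≤-refl ≤-refl) 2+i<n in
        ¬CycAdj-skip 4≤n (trans (toℕ-mod 2+i<n) (cong (2 +_) (sym (toℕ-mod i<n))))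
          (Equivalence.to (proj₂ cycle _ _ (mod-≢ i<n 2+i<n (<⇒≢ (<-trans ≤-refl ≤-refl)))) chord)
    }

induced-cycle-closing-edge : ∀ {V : Set} {E : V → V → Set} {m} {c : Fin (2 + m) → V} →
  IsInducedCycle E (2 + m) c → E (unroll c 0) (unroll c (suc m))
induced-cycle-closing-edge {m = m} cycle =
  Equivalence.from (proj₂ cycle _ _ 0≢last)
    (inj₂ (inj₂ (cong suc (toℕ-mod ≤-refl) , refl)))
  where
  0≢last : 0 mod (2 + m) ≢ suc m mod (2 + m)
  0≢last 0≡last with trans (cong toℕ 0≡last) (toℕ-mod ≤-refl)
  ... | ()

proposition2 : (V : Set) → V → (R : V → V → Pred V 0ℓ) →
    IsTransit R → JC R → J2 R → Chordal (Adj R)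
proposition2 V _ R _ jc j2 (suc (suc (suc (suc m)))) 4≤n@(s≤s (s≤s (s≤s (s≤s z≤n)))) c cycle =
  c₁∉closing-edge (adjacent-transit {R = R} (induced-cycle-closing-edge {E = Adj R} cycle)
                                    (JC+J2⇒second∈transit jc j2 (suc m) P))
  where
  P : IsShortChordFreePath (Adj R) (4 + m) (unroll c)
  P = induced-cycle⇒path cycle 4≤n
  c₁∉closing-edge : ¬ (unroll c 0 ≡ unroll c 1 ⊎ unroll c (3 + m) ≡ unroll c 1)
  c₁∉closing-edge (inj₁ c₀≡c₁) = distinct P z<s (s<s z<s) c₀≡c₁
  c₁∉closing-edge (inj₂ cₙ₋₁≡c₁) = distinct P (s<s z<s) ≤-refl (sym cₙ₋₁≡c₁)
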